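{- For every $n\ge0$, $\mathrm{p}_{132}(n)=\mathrm{p}_{231}(n)$.
   Context: A parity-alternating permutation (PAP) of $[n]$ is a permutation $\pi$ with $\pi(i)\equiv i\pmod 2$ for all $i$ (i.e. alternating in parity and starting with an odd entry). A permutation contains a pattern $\sigma$ if some subsequence of its one-line notation is order-isomorphic to $\sigma$, and avoids it otherwise. $\mathrm{p}_\sigma(n)$ is the number of PAPs of $[n]$ avoiding $\sigma$. -}

module Defs where

open import Data.Nat using (ℕ; zero; suc; _%_; _≡ᵇ_; _<ᵇ_)
open import Data.Bool using (Bool; true; false; _∧_; _∨_; not)
open import Data.Fin using (Fin; toℕ)
open import Data.List using (List; []; _∷_; map; concatMap; filter; length; allFin; and; or; upTo)
open import Data.List.Membership.Propositional using (_∈_)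
open import Data.Vec.Functional using (Vector)
open import Relation.Nullary.Decidable using (does)
open import Data.Bool using (T?)

-- A word of length n over [n] is a list of naturals; the values are 0..n-1
-- (value v here means v+1 in the paper; position i here means i+1),
-- so the parity condition π(i) ≡ i (mod 2) is unchanged by the shift.

words : ℕ → ℕ → List (List ℕ)
words n zero    = [] ∷ []
words n (suc m) = concatMap (λ v → map (v ∷_) (words n m)) (upTo n)

elem : ℕ → List ℕ → Bool
elem x []       = false
elem x (y ∷ ys) = (x ≡ᵇ y) ∨ elem x ys

distinct : List ℕ → Bool
distinct []       = true
distinct (x ∷ xs) = not (elem x xs) ∧ distinct xs

perms : ℕ → List (List ℕ)
perms n = filter (λ w → T? (distinct w)) (words n n)

papFrom : ℕ → List ℕ → Bool
papFrom i []       = true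
papFrom i (x ∷ xs) = ((x % 2) ≡ᵇ (i % 2)) ∧ papFrom (suc i) xs

isPAP : List ℕ → Bool
isPAP = papFrom 0

-- A pattern of length 3 is given by its order relations on values a,b,c
-- taken at positions i<j<k.  Contains σ = some subsequence order-isomorphic to σ.
Pat3 : Set
Pat3 = ℕ → ℕ → ℕ → Bool

pat132 : Pat3
pat132 a b c = (a <ᵇ c) ∧ (c <ᵇ b)

pat231 : Pat3
pat231 a b c = (c <ᵇ a) ∧ (a <ᵇ b)

any3 : Pat3 → ℕ → ℕ → List ℕ → Bool
any3 p a b []       = false
any3 p a b (c ∷ cs) = p a b c ∨ any3 p a b cs

any2 : Pat3 → ℕ → List ℕ → Bool
any2 p a []       = false
any2 p a (b ∷ bs) = any3 p a b bs ∨ any2 p a bs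

contains : Pat3 → List ℕ → Bool
contains p []       = false
contains p (a ∷ as) = any2 p a as ∨ contains p as

pCount : Pat3 → ℕ → ℕ
pCount σ n = length (filter (λ w → T? (isPAP w ∧ not (contains σ w))) (perms n))

-- A 132-avoiding permutation of [0..m] has the shape (α + l) m β with α and β 132-avoiding
-- permutations of [0..k) and [0..l), k + l = m: an entry x left of the maximum and an entry y
-- right of it with x < y would form the 132 x m y.
-- Reversal exchanges 132- and 231-avoiders, and it preserves parity alternation when n is odd.
-- When n = m + 1 is even, k and l have different parities, so the block exchange
-- (α + l) m β ↦ (β + k) m α, an involution of the 132-avoiders, keeps the alternation but changes
-- the parity of the first entry; reversing the result, of even length, changes it back.
module Submission where

open import Defs
open import Data.Nat
  using (ℕ; zero; suc; pred; _+_; _∸_; _≤_; _<_; z≤n; s≤s; _≟_; _<?_; _<ᵇ_; _≡ᵇ_; _%_; parity)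
open import Data.Nat.Properties
open import Data.Parity.Base as ℙ using (Parity; 0ℙ; 1ℙ; _⁻¹)
import Data.Parity.Properties as ℙ
open import Data.Bool using (Bool; true; false; T; not; _∧_; _∨_)
open import Data.Bool.Properties using (T-∧; T-∨; T-≡; ∧-assoc; ∧-comm; ∧-identityʳ)
open import Data.Unit using (tt)
open import Data.Empty using (⊥; ⊥-elim)
open import Data.Product as Product using (_×_; _,_; proj₁; proj₂; ∃-syntax)
open import Data.Sum using (inj₁; inj₂)
open import Data.List using (List; []; _∷_; _++_; [_]; map; length; reverse; filter; concatMap; upTo)
open import Data.List.Properties
  using (length-map; length-++; length-upTo; length-reverse; map-∘; map-id; map-cong; map-id-local;
         ∷-injective; unfold-reverse; reverse-involutive; filter-≐)
open import Data.List.Membership.Propositional using (_∈_; find)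
open import Data.List.Membership.Propositional.Properties
  using (∈-∃++; ∈-map⁺; ∈-map⁻; ∈-upTo⁺; ∈-upTo⁻; ∈-++⁻; ∈-++⁺ʳ; ∈-concatMap⁺; ∈-concatMap⁻;
         ∈-filter⁺; ∈-filter⁻)
open import Data.List.Membership.Propositional.Properties.WithK using (unique∧set⇒bag)
open import Data.List.Membership.DecPropositional _≟_ using (_∈?_)
open import Data.List.Relation.Binary.BagAndSetEquality using (_∼[_]_; set; ∼bag⇒↭)
open import Data.List.Relation.Binary.Disjoint.Propositional using (Disjoint)
open import Data.List.Relation.Binary.Permutation.Propositional using (_↭_; ↭-sym; ↭⇒↭ₛ)
open import Data.List.Relation.Binary.Permutation.Propositional.Properties
  using (↭-length; ↭-reverse; shift; ∈-resp-↭; All-resp-↭)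
import Data.List.Relation.Binary.Permutation.Setoid.Properties as Permutationₛ
open import Data.List.Relation.Binary.Sublist.Propositional
  using (_⊆_; []; _∷_; _∷ʳ_; minimum; ⊆-refl; ⊆-trans; lookup; to∈; from∈)
open import Data.List.Relation.Binary.Sublist.Propositional.Properties
  using (∷⁻; ++⁺; ++⁺ˡ; ++⁺ʳ; reverse⁺)
open import Data.List.Relation.Unary.All as All using (All; []; _∷_)
import Data.List.Relation.Unary.All.Properties as Allₚ
open import Data.List.Relation.Unary.Any as Any using (here; there)
open import Data.List.Relation.Unary.Unique.Propositional using (Unique; []; _∷_)
import Data.List.Relation.Unary.Unique.Propositional.Properties as Uniqueₚ
open import Function.Base using (_∘_)
open import Function.Bundles using (_⇔_; mk⇔; Equivalence)
open import Relation.Nullary using (¬_; yes; no)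
open import Relation.Nullary.Decidable using (does; does-⇔; T?)
open import Relation.Binary.Definitions using (tri<; tri≈; tri>)
open import Relation.Binary.PropositionalEquality hiding ([_])
open Equivalence using (to; from)

-- Lengths of lists without repetition

length≡-of-inverses : {A B : Set} {xs : List A} {ys : List B} (f : A → B) (g : B → A) →
  Unique xs → Unique ys →
  (∀ {x} → x ∈ xs → f x ∈ ys) → (∀ {y} → y ∈ ys → g y ∈ xs) →
  (∀ {x} → x ∈ xs → g (f x) ≡ x) → (∀ {y} → y ∈ ys → f (g y) ≡ y) →
  length xs ≡ length ys
length≡-of-inverses {xs = xs} {ys} f g xs! ys! f∈ g∈ gf fg = begin
  length xs         ≡⟨ length-map f xs ⟨
  length (map f xs) ≡⟨ ↭-length (∼bag⇒↭ (unique∧set⇒bag fxs! ys! fxs∼ys)) ⟩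
  length ys         ∎
  where
  open ≡-Reasoning
  g-after-f : map g (map f xs) ≡ xs
  g-after-f = trans (sym (map-∘ xs)) (map-id-local (All.tabulate gf))
  fxs! : Unique (map f xs)
  fxs! = Uniqueₚ.map⁻ (subst Unique (sym g-after-f) xs!)
  image⊆ys : ∀ {z} → z ∈ map f xs → z ∈ ys
  image⊆ys z∈ with x , x∈ , refl ← ∈-map⁻ f z∈ = f∈ x∈
  fxs∼ys : map f xs ∼[ set ] ys
  fxs∼ys = mk⇔ image⊆ys (λ y∈ → subst (_∈ map f xs) (fg y∈) (∈-map⁺ f (g∈ y∈)))

unique-⊆⇒length≤ : {A : Set} {xs ys : List A} → Unique xs → (∀ {z} → z ∈ xs → z ∈ ys) →
  length xs ≤ length ys
unique-⊆⇒length≤ {xs = []}     _              _     = z≤n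
unique-⊆⇒length≤ {xs = x ∷ xs} (x∉xs ∷ xs!) xs⊆ys
  with ys₁ , ys₂ , refl ← ∈-∃++ (xs⊆ys (here refl)) = begin
  suc (length xs)           ≤⟨ s≤s (unique-⊆⇒length≤ xs! xs⊆ys₁ys₂) ⟩
  suc (length (ys₁ ++ ys₂)) ≡⟨ ↭-length (shift x ys₁ ys₂) ⟨
  length (ys₁ ++ x ∷ ys₂)   ∎
  where
  open ≤-Reasoning
  xs⊆ys₁ys₂ : ∀ {z} → z ∈ xs → z ∈ ys₁ ++ ys₂
  xs⊆ys₁ys₂ z∈ with ∈-resp-↭ (shift x ys₁ ys₂) (xs⊆ys (there z∈))
  ... | here refl = ⊥-elim (All.lookup x∉xs z∈ refl)
  ... | there z∈′ = z∈′

unique-in-range⇒length+lo≤hi : ∀ {xs lo hi} → lo ≤ hi → Unique xs →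
  All (λ x → lo ≤ x × x < hi) xs → length xs + lo ≤ hi
unique-in-range⇒length+lo≤hi {xs} {lo} {hi} lo≤hi xs! in-range = begin
  length xs + lo               ≡⟨ cong (length xs +_) (length-upTo lo) ⟨
  length xs + length (upTo lo) ≡⟨ length-++ xs ⟨
  length (xs ++ upTo lo)       ≤⟨ unique-⊆⇒length≤ joint! joint⊆ ⟩
  length (upTo hi)             ≡⟨ length-upTo hi ⟩
  hi                           ∎
  where
  open ≤-Reasoning
  joint! : Unique (xs ++ upTo lo)
  joint! = Uniqueₚ.++⁺ xs! (Uniqueₚ.upTo⁺ lo)
    (λ (x∈ , x∈upTo) → <-irrefl refl (<-≤-trans (∈-upTo⁻ x∈upTo) (proj₁ (All.lookup in-range x∈))))
  joint⊆ : ∀ {z} → z ∈ xs ++ upTo lo → z ∈ upTo hi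
  joint⊆ z∈ with ∈-++⁻ xs z∈
  ... | inj₁ z∈xs   = ∈-upTo⁺ (proj₂ (All.lookup in-range z∈xs))
  ... | inj₂ z∈upTo = ∈-upTo⁺ (<-≤-trans (∈-upTo⁻ z∈upTo) lo≤hi)

Unique-++⁻ : {A : Set} (xs : List A) {ys : List A} → Unique (xs ++ ys) →
  Unique xs × Unique ys × Disjoint xs ys
Unique-++⁻ []       ys!                 = [] , ys! , λ ()
Unique-++⁻ (x ∷ xs) (x∉xsys ∷ xsys!) with xs! , ys! , xs#ys ← Unique-++⁻ xs xsys! =
  Allₚ.++⁻ˡ xs x∉xsys ∷ xs! , ys! ,
  λ { (here refl , v∈ys)  → All.lookup x∉xsys (∈-++⁺ʳ xs v∈ys) refl
    ; (there v∈xs , v∈ys) → xs#ys (v∈xs , v∈ys) }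

Unique-resp-↭ : {A : Set} {xs ys : List A} → xs ↭ ys → Unique xs → Unique ys
Unique-resp-↭ {A} xs↭ys =
  Permutationₛ.AllPairs-resp-↭ (setoid A) ≢-sym ((λ { refl x≢y → x≢y }) , (λ { refl x≢y → x≢y }))
    (↭⇒↭ₛ xs↭ys)

-- Permutations

record IsPermutation (n : ℕ) (w : List ℕ) : Set where
  field
    length≡ : length w ≡ n
    bounded : All (_< n) w
    unique  : Unique w

∈-words⁺ : ∀ {n m w} → length w ≡ m → All (_< n) w → w ∈ words n m
∈-words⁺ {w = []}            refl []            = here refl
∈-words⁺ {n} {suc m} {v ∷ w} refl (v<n ∷ w<n) =
  ∈-concatMap⁺ (λ u → map (u ∷_) (words n m))
    (Any.map (λ { refl → ∈-map⁺ (v ∷_) (∈-words⁺ refl w<n) }) (∈-upTo⁺ v<n))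

∈-words⁻ : ∀ {n} m {w} → w ∈ words n m → length w ≡ m × All (_< n) w
∈-words⁻ zero    (here refl) = refl , []
∈-words⁻ {n} (suc m) w∈
  with v , v∈ , w∈vwords ← find (∈-concatMap⁻ (λ u → map (u ∷_) (words n m)) {xs = upTo n} w∈)
  with w′ , w′∈ , refl ← ∈-map⁻ (v ∷_) w∈vwords
  with length≡ , bounded ← ∈-words⁻ m w′∈
  = cong suc length≡ , ∈-upTo⁻ v∈ ∷ bounded

words-unique : ∀ n m → Unique (words n m)
words-unique n zero    = [] ∷ []
words-unique n (suc m) = prefixed-unique (upTo n) (Uniqueₚ.upTo⁺ n)
  where
  prefixed : List ℕ → List (List ℕ)
  prefixed = concatMap (λ v → map (v ∷_) (words n m))

  head∈ : ∀ {v t} vs → v ∷ t ∈ prefixed vs → v ∈ vs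
  head∈ vs vt∈
    with u , u∈ , vt∈u ← find (∈-concatMap⁻ (λ u → map (u ∷_) (words n m)) {xs = vs} vt∈)
    with _ , _ , refl ← ∈-map⁻ (u ∷_) vt∈u
    = u∈

  prefixed-unique : ∀ vs → Unique vs → Unique (prefixed vs)
  prefixed-unique []       _             = []
  prefixed-unique (v ∷ vs) (v∉vs ∷ vs!) =
    Uniqueₚ.++⁺ (Uniqueₚ.map⁺ (proj₂ ∘ ∷-injective) (words-unique n m))
                (prefixed-unique vs vs!) disjoint
    where
    disjoint : ∀ {w} → w ∈ map (v ∷_) (words n m) × w ∈ prefixed vs → ⊥
    disjoint (w∈ , w∈vs) with _ , _ , refl ← ∈-map⁻ (v ∷_) w∈ =
      All.lookup v∉vs (head∈ vs w∈vs) refl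

T-not⇔¬T : ∀ {b} → T (not b) ⇔ (¬ T b)
T-not⇔¬T {true}  = mk⇔ (λ ()) (λ ¬t → ¬t tt)
T-not⇔¬T {false} = mk⇔ (λ _ ()) (λ _ → tt)

elem⇔∈ : ∀ {x xs} → T (elem x xs) ⇔ x ∈ xs
elem⇔∈ {x} {xs} = mk⇔ (elem→∈ xs) (∈→elem xs)
  where
  elem→∈ : ∀ xs → T (elem x xs) → x ∈ xs
  elem→∈ (y ∷ ys) t with to T-∨ t
  ... | inj₁ x≡ᵇy = here (≡ᵇ⇒≡ x y x≡ᵇy)
  ... | inj₂ x∈ys = there (elem→∈ ys x∈ys)
  ∈→elem : ∀ xs → x ∈ xs → T (elem x xs)
  ∈→elem (y ∷ ys) (here refl) = from T-∨ (inj₁ (≡⇒≡ᵇ x x refl))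
  ∈→elem (y ∷ ys) (there x∈)  = from T-∨ (inj₂ (∈→elem ys x∈))

distinct⇔Unique : ∀ {xs} → T (distinct xs) ⇔ Unique xs
distinct⇔Unique {xs} = mk⇔ (distinct→Unique xs) (Unique→distinct xs)
  where
  distinct→Unique : ∀ xs → T (distinct xs) → Unique xs
  distinct→Unique []       _ = []
  distinct→Unique (x ∷ xs) t with x∉xs , xs-distinct ← to T-∧ t =
    All.tabulate (λ y∈ x≡y → to T-not⇔¬T x∉xs (from elem⇔∈ (subst (_∈ xs) (sym x≡y) y∈)))
    ∷ distinct→Unique xs xs-distinct
  Unique→distinct : ∀ xs → Unique xs → T (distinct xs)
  Unique→distinct []       _             = tt
  Unique→distinct (x ∷ xs) (x∉xs ∷ xs!) =
    from T-∧ ( from T-not⇔¬T (λ x∈xs → All.lookup x∉xs (to elem⇔∈ x∈xs) refl)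
             , Unique→distinct xs xs!)

∈-perms⇔ : ∀ {n w} → w ∈ perms n ⇔ IsPermutation n w
∈-perms⇔ {n} {w} = mk⇔
  (λ w∈ → let w∈words , w-distinct = ∈-filter⁻ (T? ∘ distinct) w∈
              length≡ , bounded    = ∈-words⁻ n w∈words
          in record { length≡ = length≡ ; bounded = bounded ; unique = to distinct⇔Unique w-distinct })
  (λ π → ∈-filter⁺ (T? ∘ distinct) (∈-words⁺ (IsPermutation.length≡ π) (IsPermutation.bounded π))
                                   (from distinct⇔Unique (IsPermutation.unique π)))

perms-unique : ∀ n → Unique (perms n)
perms-unique n = Uniqueₚ.filter⁺ (T? ∘ distinct) (words-unique n n)

IsPermutation-resp-↭ : ∀ {n w w′} → w ↭ w′ → IsPermutation n w → IsPermutation n w′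
IsPermutation-resp-↭ w↭w′ π = record
  { length≡ = trans (sym (↭-length w↭w′)) length≡
  ; bounded = All-resp-↭ w↭w′ bounded
  ; unique  = Unique-resp-↭ w↭w′ unique
  }
  where open IsPermutation π

IsPermutation-reverse : ∀ {n w} → IsPermutation n w → IsPermutation n (reverse w)
IsPermutation-reverse {w = w} = IsPermutation-resp-↭ (↭-sym (↭-reverse w))

IsPermutation-∷max⇔ : ∀ {m w} → IsPermutation m w ⇔ IsPermutation (suc m) (m ∷ w)
IsPermutation-∷max⇔ {m} {w} = mk⇔
  (λ π → let open IsPermutation π in record
    { length≡ = cong suc length≡
    ; bounded = n<1+n m ∷ All.map m<n⇒m<1+n bounded
    ; unique  = All.map (λ x<m → ≢-sym (<⇒≢ x<m)) bounded ∷ unique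
    })
  (λ { record { length≡ = length≡ ; bounded = _ ∷ bounded ; unique = m∉w ∷ unique } → record
    { length≡ = suc-injective length≡
    ; bounded = All.zipWith (λ (x<1+m , m≢x) → ≤∧≢⇒< (≤-pred x<1+m) (≢-sym m≢x)) (bounded , m∉w)
    ; unique  = unique
    } })

IsPermutation-insertMax⇔ : ∀ {m} xs ys →
  IsPermutation m (xs ++ ys) ⇔ IsPermutation (suc m) (xs ++ m ∷ ys)
IsPermutation-insertMax⇔ {m} xs ys = mk⇔
  (λ π → IsPermutation-resp-↭ (↭-sym (shift m xs ys)) (to IsPermutation-∷max⇔ π))
  (λ π → from IsPermutation-∷max⇔ (IsPermutation-resp-↭ (shift m xs ys) π))

max∈ : ∀ {m w} → IsPermutation (suc m) w → m ∈ w
max∈ {m} {w} π with m ∈? w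
... | yes m∈w = m∈w
... | no  m∉w = ⊥-elim (1+n≰n (subst (_≤ m) (trans (+-identityʳ (length w)) length≡)
                                  (unique-in-range⇒length+lo≤hi z≤n unique below-m)))
  where
  open IsPermutation π
  below-m : All (λ x → 0 ≤ x × x < m) w
  below-m = All.tabulate λ {x} x∈w →
    z≤n , ≤∧≢⇒< (≤-pred (All.lookup bounded x∈w)) (λ { refl → m∉w x∈w })

-- Parity alternation

alternatesFrom : Parity → List ℕ → Bool
alternatesFrom p []       = true
alternatesFrom p (x ∷ xs) = does (parity x ℙ.≟ p) ∧ alternatesFrom (p ⁻¹) xs

parity-suc : ∀ n → parity (suc n) ≡ parity n ⁻¹
parity-suc zero          = refl
parity-suc (suc zero)    = refl
parity-suc (suc (suc n)) = parity-suc n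

⁻¹-+-comm : ∀ p q → (p ℙ.+ q) ⁻¹ ≡ p ⁻¹ ℙ.+ q
⁻¹-+-comm 0ℙ q = refl
⁻¹-+-comm 1ℙ q = ℙ.⁻¹-involutive q

+-⁻¹-comm : ∀ p q → (p ℙ.+ q) ⁻¹ ≡ p ℙ.+ q ⁻¹
+-⁻¹-comm 0ℙ q = refl
+-⁻¹-comm 1ℙ q = refl

⁻¹-+-⁻¹ : ∀ p q → p ⁻¹ ℙ.+ q ⁻¹ ≡ p ℙ.+ q
⁻¹-+-⁻¹ 0ℙ q = ℙ.⁻¹-involutive q
⁻¹-+-⁻¹ 1ℙ q = refl

+-twice : ∀ p q → p ℙ.+ q ℙ.+ q ≡ p
+-twice p q = trans (ℙ.+-assoc p q q) (trans (cong (p ℙ.+_) (ℙ.p+p≡0ℙ q)) (ℙ.+-identityʳ p))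

+≡1ℙ⇒≡⁻¹ : ∀ p q → p ℙ.+ q ≡ 1ℙ → p ≡ q ⁻¹
+≡1ℙ⇒≡⁻¹ 0ℙ 1ℙ _ = refl
+≡1ℙ⇒≡⁻¹ 1ℙ 0ℙ _ = refl

∧-reverse₃ : ∀ a b c → a ∧ (b ∧ c) ≡ c ∧ (b ∧ a)
∧-reverse₃ a b c = begin
  a ∧ (b ∧ c) ≡⟨ ∧-comm a (b ∧ c) ⟩
  (b ∧ c) ∧ a ≡⟨ cong (_∧ a) (∧-comm b c) ⟩
  (c ∧ b) ∧ a ≡⟨ ∧-assoc c b a ⟩
  c ∧ (b ∧ a) ∎
  where open ≡-Reasoning

+-≟-shift : ∀ a e p → does (a ℙ.+ e ℙ.≟ p) ≡ does (a ℙ.≟ p ℙ.+ e)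
+-≟-shift 0ℙ 0ℙ 0ℙ = refl
+-≟-shift 0ℙ 0ℙ 1ℙ = refl
+-≟-shift 0ℙ 1ℙ 0ℙ = refl
+-≟-shift 0ℙ 1ℙ 1ℙ = refl
+-≟-shift 1ℙ 0ℙ 0ℙ = refl
+-≟-shift 1ℙ 0ℙ 1ℙ = refl
+-≟-shift 1ℙ 1ℙ 0ℙ = refl
+-≟-shift 1ℙ 1ℙ 1ℙ = refl

%2≡ᵇ%2≡parity≟parity : ∀ x y → (x % 2 ≡ᵇ y % 2) ≡ does (parity x ℙ.≟ parity y)
%2≡ᵇ%2≡parity≟parity zero          zero          = refl
%2≡ᵇ%2≡parity≟parity zero          (suc zero)    = refl
%2≡ᵇ%2≡parity≟parity (suc zero)    zero          = refl
%2≡ᵇ%2≡parity≟parity (suc zero)    (suc zero)    = refl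
%2≡ᵇ%2≡parity≟parity (suc (suc x)) y             = %2≡ᵇ%2≡parity≟parity x y
%2≡ᵇ%2≡parity≟parity zero          (suc (suc y)) = %2≡ᵇ%2≡parity≟parity zero y
%2≡ᵇ%2≡parity≟parity (suc zero)    (suc (suc y)) = %2≡ᵇ%2≡parity≟parity (suc zero) y

papFrom≡alternatesFrom : ∀ i xs → papFrom i xs ≡ alternatesFrom (parity i) xs
papFrom≡alternatesFrom i []       = refl
papFrom≡alternatesFrom i (x ∷ xs) =
  cong₂ _∧_ (%2≡ᵇ%2≡parity≟parity x i)
            (trans (papFrom≡alternatesFrom (suc i) xs) (cong (λ p → alternatesFrom p xs) (parity-suc i)))

alternatesFrom-++ : ∀ p xs ys →
  alternatesFrom p (xs ++ ys) ≡ alternatesFrom p xs ∧ alternatesFrom (p ℙ.+ parity (length xs)) ys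
alternatesFrom-++ p []       ys = cong (λ q → alternatesFrom q ys) (sym (ℙ.+-identityʳ p))
alternatesFrom-++ p (x ∷ xs) ys = begin
  head-ok ∧ alternatesFrom (p ⁻¹) (xs ++ ys)
    ≡⟨ cong (head-ok ∧_) (alternatesFrom-++ (p ⁻¹) xs ys) ⟩
  head-ok ∧ (alternatesFrom (p ⁻¹) xs ∧ alternatesFrom (p ⁻¹ ℙ.+ parity (length xs)) ys)
    ≡⟨ ∧-assoc head-ok (alternatesFrom (p ⁻¹) xs) _ ⟨
  (head-ok ∧ alternatesFrom (p ⁻¹) xs) ∧ alternatesFrom (p ⁻¹ ℙ.+ parity (length xs)) ys
    ≡⟨ cong (λ q → (head-ok ∧ alternatesFrom (p ⁻¹) xs) ∧ alternatesFrom q ys) ys-start ⟩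
  (head-ok ∧ alternatesFrom (p ⁻¹) xs) ∧ alternatesFrom (p ℙ.+ parity (suc (length xs))) ys ∎
  where
  open ≡-Reasoning
  head-ok : Bool
  head-ok = does (parity x ℙ.≟ p)
  ys-start : p ⁻¹ ℙ.+ parity (length xs) ≡ p ℙ.+ parity (suc (length xs))
  ys-start = begin
    p ⁻¹ ℙ.+ parity (length xs)    ≡⟨ ⁻¹-+-comm p _ ⟨
    (p ℙ.+ parity (length xs)) ⁻¹  ≡⟨ +-⁻¹-comm p _ ⟩
    p ℙ.+ parity (length xs) ⁻¹    ≡⟨ cong (p ℙ.+_) (parity-suc (length xs)) ⟨
    p ℙ.+ parity (suc (length xs)) ∎

alternatesFrom-map-+ : ∀ p d xs → alternatesFrom p (map (_+ d) xs) ≡ alternatesFrom (p ℙ.+ parity d) xs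
alternatesFrom-map-+ p d []       = refl
alternatesFrom-map-+ p d (x ∷ xs) = cong₂ _∧_
  (trans (cong (λ q → does (q ℙ.≟ p)) (ℙ.+-homo-+ x d)) (+-≟-shift (parity x) (parity d) p))
  (trans (alternatesFrom-map-+ (p ⁻¹) d xs)
         (cong (λ q → alternatesFrom q xs) (sym (⁻¹-+-comm p (parity d)))))

alternatesFrom-reverse : ∀ p xs →
  alternatesFrom p (reverse xs) ≡ alternatesFrom (p ℙ.+ parity (suc (length xs))) xs
alternatesFrom-reverse p []       = refl
alternatesFrom-reverse p (x ∷ xs) = begin
  alternatesFrom p (reverse (x ∷ xs))
    ≡⟨ cong (alternatesFrom p) (unfold-reverse x xs) ⟩
  alternatesFrom p (reverse xs ++ [ x ])
    ≡⟨ alternatesFrom-++ p (reverse xs) [ x ] ⟩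
  alternatesFrom p (reverse xs) ∧ (does (parity x ℙ.≟ p ℙ.+ parity (length (reverse xs))) ∧ true)
    ≡⟨ cong₂ _∧_ (alternatesFrom-reverse p xs)
                 (trans (∧-identityʳ _)
                        (cong (λ n → does (parity x ℙ.≟ p ℙ.+ parity n)) (length-reverse xs))) ⟩
  xs-ok ∧ does (parity x ℙ.≟ q)
    ≡⟨ ∧-comm xs-ok _ ⟩
  does (parity x ℙ.≟ q) ∧ xs-ok
    ≡⟨ cong (λ r → does (parity x ℙ.≟ q) ∧ alternatesFrom r xs) q⁻¹≡p+parity-suc ⟨
  does (parity x ℙ.≟ q) ∧ alternatesFrom (q ⁻¹) xs ∎
  where
  open ≡-Reasoning
  q : Parity
  q = p ℙ.+ parity (length xs)
  xs-ok : Bool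
  xs-ok = alternatesFrom (p ℙ.+ parity (suc (length xs))) xs
  q⁻¹≡p+parity-suc : q ⁻¹ ≡ p ℙ.+ parity (suc (length xs))
  q⁻¹≡p+parity-suc = trans (+-⁻¹-comm p _) (cong (p ℙ.+_) (sym (parity-suc (length xs))))

-- Pattern occurrences

Occurs : Pat3 → List ℕ → Set
Occurs σ w = ∃[ a ] ∃[ b ] ∃[ c ] (a ∷ b ∷ c ∷ [] ⊆ w × T (σ a b c))

contains⇔Occurs : ∀ {σ w} → T (contains σ w) ⇔ Occurs σ w
contains⇔Occurs {σ} = mk⇔ (toOccurs _) (fromOccurs _)
  where
  any3⇒ : ∀ a b cs → T (any3 σ a b cs) → ∃[ c ] (c ∷ [] ⊆ cs × T (σ a b c))
  any3⇒ a b (c ∷ cs) t with to T-∨ t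
  ... | inj₁ σabc = c , refl ∷ minimum cs , σabc
  ... | inj₂ t′   with c′ , c′⊆ , σabc′ ← any3⇒ a b cs t′ = c′ , c ∷ʳ c′⊆ , σabc′

  ⇒any3 : ∀ a b c cs → c ∷ [] ⊆ cs → T (σ a b c) → T (any3 σ a b cs)
  ⇒any3 a b c (_ ∷ cs) (refl ∷ _) σabc = from T-∨ (inj₁ σabc)
  ⇒any3 a b c (_ ∷ cs) (_ ∷ʳ c⊆)  σabc = from T-∨ (inj₂ (⇒any3 a b c cs c⊆ σabc))

  any2⇒ : ∀ a bs → T (any2 σ a bs) → ∃[ b ] ∃[ c ] (b ∷ c ∷ [] ⊆ bs × T (σ a b c))
  any2⇒ a (b ∷ bs) t with to T-∨ t
  ... | inj₁ t′ with c , c⊆ , σabc ← any3⇒ a b bs t′ = b , c , refl ∷ c⊆ , σabc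
  ... | inj₂ t′ with b′ , c , bc⊆ , σab′c ← any2⇒ a bs t′ = b′ , c , b ∷ʳ bc⊆ , σab′c

  ⇒any2 : ∀ a b c bs → b ∷ c ∷ [] ⊆ bs → T (σ a b c) → T (any2 σ a bs)
  ⇒any2 a b c (_ ∷ bs) (refl ∷ c⊆) σabc = from T-∨ (inj₁ (⇒any3 a b c bs c⊆ σabc))
  ⇒any2 a b c (_ ∷ bs) (_ ∷ʳ bc⊆)  σabc = from T-∨ (inj₂ (⇒any2 a b c bs bc⊆ σabc))

  toOccurs : ∀ w → T (contains σ w) → Occurs σ w
  toOccurs (a ∷ w) t with to T-∨ t
  ... | inj₁ t′ with b , c , bc⊆ , σabc ← any2⇒ a w t′ = a , b , c , refl ∷ bc⊆ , σabc
  ... | inj₂ t′ with a′ , b , c , abc⊆ , σa′bc ← toOccurs w t′ = a′ , b , c , a ∷ʳ abc⊆ , σa′bc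

  fromOccurs : ∀ w → Occurs σ w → T (contains σ w)
  fromOccurs (_ ∷ w) (a , b , c , refl ∷ bc⊆ , σabc) = from T-∨ (inj₁ (⇒any2 a b c w bc⊆ σabc))
  fromOccurs (_ ∷ w) (a , b , c , _ ∷ʳ abc⊆ , σabc)  =
    from T-∨ (inj₂ (fromOccurs w (a , b , c , abc⊆ , σabc)))

Occurs-⊆ : ∀ {σ xs ys} → xs ⊆ ys → Occurs σ xs → Occurs σ ys
Occurs-⊆ xs⊆ys (a , b , c , abc⊆xs , σabc) = a , b , c , ⊆-trans abc⊆xs xs⊆ys , σabc

reversePattern : Pat3 → Pat3
reversePattern σ a b c = σ c b a

Occurs-reverse : ∀ {σ w} → Occurs σ w → Occurs (reversePattern σ) (reverse w)
Occurs-reverse (a , b , c , abc⊆w , σabc) = c , b , a , reverse⁺ abc⊆w , σabc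

TranslationInvariant : Pat3 → Set
TranslationInvariant σ = ∀ d a b c → σ (a + d) (b + d) (c + d) ≡ σ a b c

contains-map-+ : ∀ {σ} → TranslationInvariant σ → ∀ d w →
  contains σ (map (_+ d) w) ≡ contains σ w
contains-map-+ {σ} inv d = containsShifted
  where
  any3Shifted : ∀ a b cs → any3 σ (a + d) (b + d) (map (_+ d) cs) ≡ any3 σ a b cs
  any3Shifted a b []       = refl
  any3Shifted a b (c ∷ cs) = cong₂ _∨_ (inv d a b c) (any3Shifted a b cs)
  any2Shifted : ∀ a bs → any2 σ (a + d) (map (_+ d) bs) ≡ any2 σ a bs
  any2Shifted a []       = refl
  any2Shifted a (b ∷ bs) = cong₂ _∨_ (any3Shifted a b bs) (any2Shifted a bs)
  containsShifted : ∀ w → contains σ (map (_+ d) w) ≡ contains σ w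
  containsShifted []      = refl
  containsShifted (a ∷ w) = cong₂ _∨_ (any2Shifted a w) (containsShifted w)

Occurs-map-+⇔ : ∀ {σ} → TranslationInvariant σ → ∀ d {w} →
  Occurs σ (map (_+ d) w) ⇔ Occurs σ w
Occurs-map-+⇔ {σ} inv d {w} = mk⇔
  (λ o → to contains⇔Occurs (subst T (contains-map-+ inv d w) (from contains⇔Occurs o)))
  (λ o → to contains⇔Occurs (subst T (sym (contains-map-+ inv d w)) (from contains⇔Occurs o)))

<ᵇ-+-cancel : ∀ d a b → ((a + d) <ᵇ (b + d)) ≡ (a <ᵇ b)
<ᵇ-+-cancel d a b = does-⇔ (mk⇔ (+-cancelʳ-< d a b) (+-monoˡ-< d)) (a + d <? b + d) (a <? b)

pat132-translationInvariant : TranslationInvariant pat132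
pat132-translationInvariant d a b c = cong₂ _∧_ (<ᵇ-+-cancel d a c) (<ᵇ-+-cancel d c b)

T-pat132⇔ : ∀ {a b c} → T (pat132 a b c) ⇔ (a < c × c < b)
T-pat132⇔ {a} {b} {c} = mk⇔
  (λ t → let a<ᵇc , c<ᵇb = to T-∧ t in <ᵇ⇒< a c a<ᵇc , <ᵇ⇒< c b c<ᵇb)
  (λ (a<c , c<b) → from T-∧ (<⇒<ᵇ a<c , <⇒<ᵇ c<b))

⊆-++⁻ : {A : Set} (xs : List A) {ys as : List A} → as ⊆ xs ++ ys →
  ∃[ as₁ ] ∃[ as₂ ] (as ≡ as₁ ++ as₂ × as₁ ⊆ xs × as₂ ⊆ ys)
⊆-++⁻ []       {as = as} as⊆ = [] , as , refl , [] , as⊆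
⊆-++⁻ (x ∷ xs) (refl ∷ as⊆)
  with as₁ , as₂ , refl , as₁⊆ , as₂⊆ ← ⊆-++⁻ xs as⊆
  = x ∷ as₁ , as₂ , refl , refl ∷ as₁⊆ , as₂⊆
⊆-++⁻ (x ∷ xs) (_ ∷ʳ as⊆)
  with as₁ , as₂ , refl , as₁⊆ , as₂⊆ ← ⊆-++⁻ xs as⊆
  = as₁ , as₂ , refl , x ∷ʳ as₁⊆ , as₂⊆

-- Decomposition of 132-avoiders at the maximum

_≻_ : List ℕ → List ℕ → Set
xs ≻ ys = ∀ {x y} → x ∈ xs → y ∈ ys → y < x

-- An occurrence a b c (a < c < b) cannot have the peak m as a or as c, nor a left and c right of m.
avoids132-around-peak : ∀ {m xs ys} → All (_< m) xs → All (_< m) ys → xs ≻ ys →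
  ¬ Occurs pat132 xs → ¬ Occurs pat132 ys → ¬ Occurs pat132 (xs ++ m ∷ ys)
avoids132-around-peak {m} {xs} {ys} xs<m ys<m xs≻ys xs-avoids ys-avoids (a , b , c , abc⊆ , σabc)
  with a<c , c<b ← to T-pat132⇔ σabc
  with ⊆-++⁻ xs abc⊆
... | [] , _ , refl , _ , refl ∷ bc⊆ys = <-asym a<c (All.lookup ys<m (lookup bc⊆ys (there (here refl))))
... | [] , _ , refl , _ , _ ∷ʳ abc⊆ys = ys-avoids (a , b , c , abc⊆ys , σabc)
... | _ ∷ [] , _ , refl , a⊆xs , bc⊆ = <-asym a<c (xs≻ys (lookup a⊆xs (here refl)) (to∈ (∷⁻ bc⊆)))
... | _ ∷ _ ∷ [] , _ , refl , ab⊆xs , refl ∷ _ =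
  <-asym c<b (All.lookup xs<m (lookup ab⊆xs (there (here refl))))
... | _ ∷ _ ∷ [] , _ , refl , ab⊆xs , _ ∷ʳ c⊆ys =
  <-asym a<c (xs≻ys (lookup ab⊆xs (here refl)) (to∈ c⊆ys))
... | _ ∷ _ ∷ _ ∷ [] , _ , refl , abc⊆xs , _ = xs-avoids (a , b , c , abc⊆xs , σabc)

avoids132-at-peak⇒≻ : ∀ {m xs ys} → All (_< m) ys → Disjoint xs ys →
  ¬ Occurs pat132 (xs ++ m ∷ ys) → xs ≻ ys
avoids132-at-peak⇒≻ {m} ys<m xs#ys avoids {x} {y} x∈xs y∈ys with <-cmp x y
... | tri< x<y _ _ = ⊥-elim (avoids (x , m , y , ++⁺ (from∈ x∈xs) (refl ∷ from∈ y∈ys) ,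
                                      from T-pat132⇔ (x<y , All.lookup ys<m y∈ys)))
... | tri≈ _ refl _ = ⊥-elim (xs#ys (x∈xs , y∈ys))
... | tri> _ _ y<x = y<x

IsPermutation-skew⁺ : ∀ {k l α β} → IsPermutation k α → IsPermutation l β →
  IsPermutation (k + l) (map (_+ l) α ++ β) × map (_+ l) α ≻ β
IsPermutation-skew⁺ {k} {l} {α} {β} πα πβ =
  record
    { length≡ = trans (length-++ (map (_+ l) α))
                      (cong₂ _+_ (trans (length-map (_+ l) α) Pα.length≡) Pβ.length≡)
    ; bounded = Allₚ.++⁺ (Allₚ.map⁺ (All.map (+-monoˡ-< l) Pα.bounded))
                         (All.map (λ y<l → <-≤-trans y<l (m≤n+m l k)) Pβ.bounded)
    ; unique  = Uniqueₚ.++⁺ (Uniqueₚ.map⁺ (+-cancelʳ-≡ l _ _) Pα.unique) Pβ.unique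
                            (λ (x∈ , x∈β) → <-irrefl refl (α⁺≻β x∈ x∈β))
    }
  , α⁺≻β
  where
  module Pα = IsPermutation πα
  module Pβ = IsPermutation πβ
  α⁺≻β : map (_+ l) α ≻ β
  α⁺≻β x∈ y∈β with a , _ , refl ← ∈-map⁻ (_+ l) x∈ = <-≤-trans (All.lookup Pβ.bounded y∈β) (m≤n+m l a)

IsPermutation-skew⁻ : ∀ {m xs ys} → IsPermutation m (xs ++ ys) → xs ≻ ys →
  ∃[ α ] (xs ≡ map (_+ length ys) α × IsPermutation (length xs) α × IsPermutation (length ys) ys)
IsPermutation-skew⁻ {m} {xs} {ys} π xs≻ys =
  map (_∸ l) xs , sym shift-back ,
  record
    { length≡ = length-map (_∸ l) xs
    ; bounded = Allₚ.map⁺ (All.tabulate (λ x∈ → x∸l<k (All.lookup xs<m x∈) (l≤ x∈)))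
    ; unique  = Uniqueₚ.map⁻ (subst Unique (sym shift-back) xs!)
    } ,
  record { length≡ = refl ; bounded = All.tabulate <l ; unique = ys! }
  where
  open IsPermutation π
  k l : ℕ
  k = length xs
  l = length ys
  k+l≡m : k + l ≡ m
  k+l≡m = trans (sym (length-++ xs)) length≡
  xs<m : All (_< m) xs
  xs<m = Allₚ.++⁻ˡ xs bounded
  ys<m : All (_< m) ys
  ys<m = Allₚ.++⁻ʳ xs bounded
  xs! : Unique xs
  xs! = proj₁ (Unique-++⁻ xs unique)
  ys! : Unique ys
  ys! = proj₁ (proj₂ (Unique-++⁻ xs unique))
  l≤ : ∀ {x} → x ∈ xs → l ≤ x
  l≤ {x} x∈ = subst (_≤ x) (+-identityʳ l)
    (unique-in-range⇒length+lo≤hi z≤n ys! (All.tabulate (λ y∈ → z≤n , xs≻ys x∈ y∈)))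
  <l : ∀ {y} → y ∈ ys → y < l
  <l {y} y∈ = +-cancelˡ-≤ k (suc y) l (subst (k + suc y ≤_) (sym k+l≡m)
    (unique-in-range⇒length+lo≤hi (All.lookup ys<m y∈) xs!
      (All.tabulate (λ x∈ → xs≻ys x∈ y∈ , All.lookup xs<m x∈))))
  x∸l<k : ∀ {x} → x < m → l ≤ x → x ∸ l < k
  x∸l<k {x} x<m l≤x =
    subst (x ∸ l <_) (m+n∸n≡m k l) (∸-monoˡ-< (subst (x <_) (sym k+l≡m) x<m) l≤x)
  shift-back : map (_+ l) (map (_∸ l) xs) ≡ xs
  shift-back = trans (sym (map-∘ xs)) (map-id-local (All.tabulate (λ x∈ → m∸n+n≡m (l≤ x∈))))

peakJoin : List ℕ → List ℕ → List ℕ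
peakJoin α β = map (_+ length β) α ++ (length α + length β) ∷ β

length-peakJoin : ∀ α β → length (peakJoin α β) ≡ suc (length α + length β)
length-peakJoin α β = begin
  length (map (_+ length β) α ++ (length α + length β) ∷ β) ≡⟨ length-++ (map (_+ length β) α) ⟩
  length (map (_+ length β) α) + suc (length β)
    ≡⟨ cong (_+ suc (length β)) (length-map (_+ length β) α) ⟩
  length α + suc (length β)                                ≡⟨ +-suc (length α) (length β) ⟩
  suc (length α + length β)                                ∎
  where open ≡-Reasoning

Avoids132Permutation : List ℕ → Set
Avoids132Permutation w = IsPermutation (length w) w × ¬ Occurs pat132 w

peakJoin-avoids132 : ∀ {α β} → Avoids132Permutation α → Avoids132Permutation β →
  IsPermutation (suc (length α + length β)) (peakJoin α β) × ¬ Occurs pat132 (peakJoin α β)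
peakJoin-avoids132 {α} {β} (πα , α-avoids) (πβ , β-avoids)
  with π , α⁺≻β ← IsPermutation-skew⁺ πα πβ =
  to (IsPermutation-insertMax⇔ (map (_+ length β) α) β) π ,
  avoids132-around-peak (Allₚ.++⁻ˡ _ bounded) (Allₚ.++⁻ʳ _ bounded) α⁺≻β
    (λ o → α-avoids (to (Occurs-map-+⇔ pat132-translationInvariant (length β)) o)) β-avoids
  where open IsPermutation π

avoids132-peakJoin : ∀ {m w} → IsPermutation (suc m) w → ¬ Occurs pat132 w →
  ∃[ α ] ∃[ β ] (w ≡ peakJoin α β × Avoids132Permutation α × Avoids132Permutation β)
avoids132-peakJoin {m} π w-avoids
  with xs , ys , refl ← ∈-∃++ (max∈ π)
  with π′ ← from (IsPermutation-insertMax⇔ xs ys) π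
  with _ , _ , xs#ys ← Unique-++⁻ xs (IsPermutation.unique π′)
  with α , xs≡α⁺ , πα , πys ← IsPermutation-skew⁻ π′
      (avoids132-at-peak⇒≻ (Allₚ.++⁻ʳ xs (IsPermutation.bounded π′)) xs#ys w-avoids)
  = α , ys , w≡peakJoin
  , (subst (λ k → IsPermutation k α) (sym |α|≡|xs|) πα , α-avoids)
  , (πys , ys-avoids)
  where
  |α|≡|xs| : length α ≡ length xs
  |α|≡|xs| = IsPermutation.length≡ πα
  w≡peakJoin : xs ++ m ∷ ys ≡ peakJoin α ys
  w≡peakJoin = cong₂ (λ as k → as ++ k ∷ ys) xs≡α⁺
    (sym (trans (cong (_+ length ys) |α|≡|xs|) (trans (sym (length-++ xs)) (IsPermutation.length≡ π′))))
  α-avoids : ¬ Occurs pat132 α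
  α-avoids o = w-avoids (Occurs-⊆ (++⁺ʳ (m ∷ ys) ⊆-refl)
    (subst (Occurs pat132) (sym xs≡α⁺) (from (Occurs-map-+⇔ pat132-translationInvariant (length ys)) o)))
  ys-avoids : ¬ Occurs pat132 ys
  ys-avoids o = w-avoids (Occurs-⊆ (++⁺ˡ xs (m ∷ʳ ⊆-refl)) o)

splitAtValue : ℕ → List ℕ → List ℕ × List ℕ
splitAtValue m []       = [] , []
splitAtValue m (x ∷ xs) with x ≟ m
... | yes _ = [] , xs
... | no  _ = Product.map₁ (x ∷_) (splitAtValue m xs)

splitAtValue-++ : ∀ m xs ys → All (_≢ m) xs → splitAtValue m (xs ++ m ∷ ys) ≡ (xs , ys)
splitAtValue-++ m []       ys []               with m ≟ m
... | yes _   = refl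
... | no  m≢m = ⊥-elim (m≢m refl)
splitAtValue-++ m (x ∷ xs) ys (x≢m ∷ xs≢m) with x ≟ m
... | yes x≡m = ⊥-elim (x≢m x≡m)
... | no  _   = cong (Product.map₁ (x ∷_)) (splitAtValue-++ m xs ys xs≢m)

swapAround : ℕ → List ℕ × List ℕ → List ℕ
swapAround m (xs , ys) = map (_+ length xs) ys ++ m ∷ map (_∸ length ys) xs

-- Junk unless w = peakJoin α β with α a permutation; then see swapBlocks-peakJoin.
swapBlocks : List ℕ → List ℕ
swapBlocks w = swapAround (pred (length w)) (splitAtValue (pred (length w)) w)

swapBlocks-peakJoin : ∀ {α β} → All (_< length α) α → swapBlocks (peakJoin α β) ≡ peakJoin β α
swapBlocks-peakJoin {α} {β} α<k = begin
  swapBlocks (peakJoin α β)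
    ≡⟨ cong (λ n → swapAround n (splitAtValue n (peakJoin α β))) (cong pred (length-peakJoin α β)) ⟩
  swapAround (k + l) (splitAtValue (k + l) (map (_+ l) α ++ (k + l) ∷ β))
    ≡⟨ cong (swapAround (k + l)) (splitAtValue-++ (k + l) (map (_+ l) α) β α⁺≢peak) ⟩
  map (_+ length (map (_+ l) α)) β ++ (k + l) ∷ map (_∸ l) (map (_+ l) α)
    ≡⟨ cong₂ _++_ (cong (λ d → map (_+ d) β) (length-map (_+ l) α))
                  (cong₂ _∷_ (+-comm k l) unshift) ⟩
  peakJoin β α ∎
  where
  open ≡-Reasoning
  k l : ℕ
  k = length α
  l = length β
  α⁺≢peak : All (_≢ k + l) (map (_+ l) α)
  α⁺≢peak = Allₚ.map⁺ (All.map (λ a<k → <⇒≢ (+-monoˡ-< l a<k)) α<k)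
  unshift : map (_∸ l) (map (_+ l) α) ≡ α
  unshift = trans (sym (map-∘ α)) (trans (map-cong (λ a → m+n∸n≡m a l) α) (map-id α))

alternatesFrom-peakJoin : ∀ p α β →
  alternatesFrom p (peakJoin α β) ≡
  alternatesFrom (p ℙ.+ parity (length β)) α ∧
    (does (parity (length α + length β) ℙ.≟ p ℙ.+ parity (length α)) ∧
     alternatesFrom (p ℙ.+ parity (suc (length α))) β)
alternatesFrom-peakJoin p α β = begin
  alternatesFrom p (map (_+ l) α ++ (k + l) ∷ β)
    ≡⟨ alternatesFrom-++ p (map (_+ l) α) ((k + l) ∷ β) ⟩
  alternatesFrom p (map (_+ l) α) ∧ alternatesFrom (p ℙ.+ parity (length (map (_+ l) α))) ((k + l) ∷ β)
    ≡⟨ cong₂ _∧_ (alternatesFrom-map-+ p l α)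
                 (cong (λ n → alternatesFrom (p ℙ.+ parity n) ((k + l) ∷ β)) (length-map (_+ l) α)) ⟩
  α-ok ∧ (peak-ok ∧ alternatesFrom ((p ℙ.+ parity k) ⁻¹) β)
    ≡⟨ cong (λ q → α-ok ∧ (peak-ok ∧ alternatesFrom q β)) (+-⁻¹-comm p (parity k)) ⟩
  α-ok ∧ (peak-ok ∧ alternatesFrom (p ℙ.+ parity k ⁻¹) β)
    ≡⟨ cong (λ q → α-ok ∧ (peak-ok ∧ alternatesFrom (p ℙ.+ q) β)) (parity-suc k) ⟨
  α-ok ∧ (peak-ok ∧ alternatesFrom (p ℙ.+ parity (suc k)) β) ∎
  where
  open ≡-Reasoning
  k l : ℕ
  k = length α
  l = length β
  α-ok peak-ok : Bool
  α-ok    = alternatesFrom (p ℙ.+ parity l) α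
  peak-ok = does (parity (k + l) ℙ.≟ p ℙ.+ parity k)

alternatesFrom-peakJoin-swap : ∀ p α β → parity (length α + length β) ≡ 1ℙ →
  alternatesFrom (p ⁻¹) (peakJoin β α) ≡ alternatesFrom p (peakJoin α β)
alternatesFrom-peakJoin-swap p α β k+l-odd = begin
  alternatesFrom (p ⁻¹) (peakJoin β α)
    ≡⟨ alternatesFrom-peakJoin (p ⁻¹) β α ⟩
  alternatesFrom (p ⁻¹ ℙ.+ parity k) β ∧
    (does (parity (l + k) ℙ.≟ p ⁻¹ ℙ.+ parity l) ∧ alternatesFrom (p ⁻¹ ℙ.+ parity (suc l)) α)
    ≡⟨ cong₂ _∧_ (cong (λ q → alternatesFrom q β) β-start)
                 (cong₂ _∧_ (cong₂ (λ n q → does (parity n ℙ.≟ q)) (+-comm l k) peak-parity)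
                            (cong (λ q → alternatesFrom q α) α-start)) ⟩
  β-ok ∧ (peak-ok ∧ α-ok) ≡⟨ ∧-reverse₃ β-ok peak-ok α-ok ⟩
  α-ok ∧ (peak-ok ∧ β-ok)
    ≡⟨ alternatesFrom-peakJoin p α β ⟨
  alternatesFrom p (peakJoin α β) ∎
  where
  open ≡-Reasoning
  k l : ℕ
  k = length α
  l = length β
  α-ok β-ok peak-ok : Bool
  α-ok    = alternatesFrom (p ℙ.+ parity l) α
  β-ok    = alternatesFrom (p ℙ.+ parity (suc k)) β
  peak-ok = does (parity (k + l) ℙ.≟ p ℙ.+ parity k)
  β-start : p ⁻¹ ℙ.+ parity k ≡ p ℙ.+ parity (suc k)
  β-start = trans (sym (⁻¹-+-comm p (parity k)))
                  (trans (+-⁻¹-comm p (parity k)) (cong (p ℙ.+_) (sym (parity-suc k))))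
  α-start : p ⁻¹ ℙ.+ parity (suc l) ≡ p ℙ.+ parity l
  α-start = trans (cong (p ⁻¹ ℙ.+_) (parity-suc l)) (⁻¹-+-⁻¹ p (parity l))
  k+l-odd′ : parity k ℙ.+ parity l ≡ 1ℙ
  k+l-odd′ = trans (sym (ℙ.+-homo-+ k l)) k+l-odd
  peak-parity : p ⁻¹ ℙ.+ parity l ≡ p ℙ.+ parity k
  peak-parity = begin
    p ⁻¹ ℙ.+ parity l     ≡⟨ ⁻¹-+-comm p (parity l) ⟨
    (p ℙ.+ parity l) ⁻¹   ≡⟨ +-⁻¹-comm p (parity l) ⟩
    p ℙ.+ parity l ⁻¹     ≡⟨ cong (p ℙ.+_) (+≡1ℙ⇒≡⁻¹ (parity k) (parity l) k+l-odd′) ⟨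
    p ℙ.+ parity k        ∎

-- Counting parity-alternating avoiders

admissible : Pat3 → Parity → List ℕ → Bool
admissible σ p w = alternatesFrom p w ∧ not (contains σ w)

avoiders : Pat3 → Parity → ℕ → List (List ℕ)
avoiders σ p n = filter (T? ∘ admissible σ p) (perms n)

record IsAvoider (σ : Pat3) (p : Parity) (n : ℕ) (w : List ℕ) : Set where
  field
    isPermutation : IsPermutation n w
    alternates    : alternatesFrom p w ≡ true
    avoids        : ¬ Occurs σ w

∈-avoiders⇔ : ∀ {σ p n w} → w ∈ avoiders σ p n ⇔ IsAvoider σ p n w
∈-avoiders⇔ {σ} {p} = mk⇔
  (λ w∈ → let w∈perms , t   = ∈-filter⁻ (T? ∘ admissible σ p) w∈
              alt , ¬contains = to T-∧ t
          in record { isPermutation = to ∈-perms⇔ w∈perms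
                    ; alternates    = to T-≡ alt
                    ; avoids        = λ o → to T-not⇔¬T ¬contains (from contains⇔Occurs o) })
  (λ A → ∈-filter⁺ (T? ∘ admissible σ p) (from ∈-perms⇔ (IsAvoider.isPermutation A))
           (from T-∧ (from T-≡ (IsAvoider.alternates A) ,
                      from T-not⇔¬T (λ t → IsAvoider.avoids A (to contains⇔Occurs t)))))

avoiders-unique : ∀ σ p n → Unique (avoiders σ p n)
avoiders-unique σ p n = Uniqueₚ.filter⁺ (T? ∘ admissible σ p) (perms-unique n)

filter-T?-cong : ∀ {A : Set} {f g : A → Bool} → (∀ x → f x ≡ g x) →
  filter (T? ∘ f) ≗ filter (T? ∘ g)
filter-T?-cong {f = f} {g} f≗g =
  filter-≐ (T? ∘ f) (T? ∘ g) ((λ {x} → subst T (f≗g x)) , (λ {x} → subst T (sym (f≗g x))))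

pCount≡length-avoiders : ∀ σ n → pCount σ n ≡ length (avoiders σ 0ℙ n)
pCount≡length-avoiders σ n =
  cong length (filter-T?-cong (λ w → cong (_∧ not (contains σ w)) (papFrom≡alternatesFrom 0 w))
                              (perms n))

length-avoiders-≡ : ∀ {σ τ p q m n} (f g : List ℕ → List ℕ) →
  (∀ {w} → IsAvoider σ p m w → IsAvoider τ q n (f w)) →
  (∀ {w} → IsAvoider τ q n w → IsAvoider σ p m (g w)) →
  (∀ {w} → IsAvoider σ p m w → g (f w) ≡ w) →
  (∀ {w} → IsAvoider τ q n w → f (g w) ≡ w) →
  length (avoiders σ p m) ≡ length (avoiders τ q n)
length-avoiders-≡ {σ} {τ} {p} {q} {m} {n} f g f-avoider g-avoider gf fg =
  length≡-of-inverses f g (avoiders-unique σ p m) (avoiders-unique τ q n)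
    (λ w∈ → from ∈-avoiders⇔ (f-avoider (to ∈-avoiders⇔ w∈)))
    (λ w∈ → from ∈-avoiders⇔ (g-avoider (to ∈-avoiders⇔ w∈)))
    (λ w∈ → gf (to (∈-avoiders⇔ {σ} {p} {m}) w∈))
    (λ w∈ → fg (to (∈-avoiders⇔ {τ} {q} {n}) w∈))

reverse-avoider : ∀ {σ p n w} → IsAvoider σ p n w →
  IsAvoider (reversePattern σ) (p ℙ.+ parity (suc n)) n (reverse w)
reverse-avoider {σ} {p} {n} {w} A = record
  { isPermutation = IsPermutation-reverse isPermutation
  ; alternates    = begin
      alternatesFrom (p ℙ.+ parity (suc n)) (reverse w)
        ≡⟨ alternatesFrom-reverse _ w ⟩
      alternatesFrom (p ℙ.+ parity (suc n) ℙ.+ parity (suc (length w))) w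
        ≡⟨ cong (λ k → alternatesFrom (p ℙ.+ parity (suc n) ℙ.+ parity (suc k)) w)
                (IsPermutation.length≡ isPermutation) ⟩
      alternatesFrom (p ℙ.+ parity (suc n) ℙ.+ parity (suc n)) w
        ≡⟨ cong (λ q → alternatesFrom q w) (+-twice p (parity (suc n))) ⟩
      alternatesFrom p w
        ≡⟨ alternates ⟩
      true ∎
  ; avoids        = λ o → avoids (subst (Occurs σ) (reverse-involutive w) (Occurs-reverse o))
  }
  where
  open IsAvoider A
  open ≡-Reasoning

length-avoiders-reverse : ∀ σ p n →
  length (avoiders σ p n) ≡ length (avoiders (reversePattern σ) (p ℙ.+ parity (suc n)) n)
length-avoiders-reverse σ p n = length-avoiders-≡ reverse reverse reverse-avoider
  (λ A → subst (λ q → IsAvoider σ q n _) (+-twice p (parity (suc n))) (reverse-avoider A))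
  (λ {w} _ → reverse-involutive w) (λ {w} _ → reverse-involutive w)

swapBlocks-avoider : ∀ {p m w} → parity m ≡ 1ℙ → IsAvoider pat132 p (suc m) w →
  IsAvoider pat132 (p ⁻¹) (suc m) (swapBlocks w)
swapBlocks-avoider {p} {m} m-odd A
  with α , β , refl , α-av@(πα , _) , β-av ← avoids132-peakJoin (IsAvoider.isPermutation A) (IsAvoider.avoids A)
  with πβα , βα-avoids ← peakJoin-avoids132 β-av α-av
  = subst (IsAvoider pat132 (p ⁻¹) (suc m)) (sym (swapBlocks-peakJoin (IsPermutation.bounded πα))) record
    { isPermutation = subst (λ k → IsPermutation (suc k) (peakJoin β α))
                            (trans (+-comm (length β) (length α)) k+l≡m) πβα
    ; alternates    = trans (alternatesFrom-peakJoin-swap p α β (trans (cong parity k+l≡m) m-odd))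
                            (IsAvoider.alternates A)
    ; avoids        = βα-avoids
    }
  where
  k+l≡m : length α + length β ≡ m
  k+l≡m = suc-injective
    (trans (sym (length-peakJoin α β)) (IsPermutation.length≡ (IsAvoider.isPermutation A)))

swapBlocks-involutive : ∀ {p n w} → IsAvoider pat132 p (suc n) w → swapBlocks (swapBlocks w) ≡ w
swapBlocks-involutive A
  with α , β , refl , (πα , _) , (πβ , _) ← avoids132-peakJoin (IsAvoider.isPermutation A) (IsAvoider.avoids A)
  = trans (cong swapBlocks (swapBlocks-peakJoin (IsPermutation.bounded πα)))
          (swapBlocks-peakJoin (IsPermutation.bounded πβ))

length-avoiders132-swap : ∀ p m → parity m ≡ 1ℙ →
  length (avoiders pat132 p (suc m)) ≡ length (avoiders pat132 (p ⁻¹) (suc m))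
length-avoiders132-swap p m m-odd = length-avoiders-≡ swapBlocks swapBlocks (swapBlocks-avoider m-odd)
  (λ A → subst (λ q → IsAvoider pat132 q (suc m) _) (ℙ.⁻¹-involutive p) (swapBlocks-avoider m-odd A))
  swapBlocks-involutive swapBlocks-involutive

mainTheorem7 : (n : ℕ) → pCount pat132 n ≡ pCount pat231 n
mainTheorem7 zero = refl
mainTheorem7 (suc m) with parity m in m-parity
-- reversePattern pat132 is pat231 by definition.
... | 0ℙ = begin
  pCount pat132 (suc m)                   ≡⟨ pCount≡length-avoiders pat132 (suc m) ⟩
  length (avoiders pat132 0ℙ (suc m))     ≡⟨ length-avoiders-reverse pat132 0ℙ (suc m) ⟩
  length (avoiders pat231 (parity m) (suc m))
                                          ≡⟨ cong (λ q → length (avoiders pat231 q (suc m))) m-parity ⟩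
  length (avoiders pat231 0ℙ (suc m))     ≡⟨ pCount≡length-avoiders pat231 (suc m) ⟨
  pCount pat231 (suc m)                   ∎
  where open ≡-Reasoning
... | 1ℙ = begin
  pCount pat132 (suc m)                   ≡⟨ pCount≡length-avoiders pat132 (suc m) ⟩
  length (avoiders pat132 0ℙ (suc m))     ≡⟨ length-avoiders132-swap 0ℙ m m-parity ⟩
  length (avoiders pat132 1ℙ (suc m))     ≡⟨ length-avoiders-reverse pat132 1ℙ (suc m) ⟩
  length (avoiders pat231 (parity m ⁻¹) (suc m))
                                          ≡⟨ cong (λ q → length (avoiders pat231 (q ⁻¹) (suc m))) m-parity ⟩
  length (avoiders pat231 0ℙ (suc m))     ≡⟨ pCount≡length-avoiders pat231 (suc m) ⟨
  pCount pat231 (suc m)                   ∎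
  where open ≡-Reasoning
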